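{- Let $n\ge 1$ and let $T$ be a state of the Bergman Game reachable from ${}_0(n)$ by a finite sequence of moves, such that $T_i \in \{0,1\}$ for all $i$. Let $L$ be a real number with $-L \leq -\log_\varphi n - 3$, where $\varphi=\frac{1+\sqrt5}{2}$, and suppose the leftmost chip of $T$ is at index $m = \min\{i: T_i>0\} \leq -L$. Put $z_L = \left\lfloor \frac{L - \log_\varphi n - 3}{2} \right\rfloor$. Then $T_m = 1$, $T_{m+2j+1} = 1$ for all $0 \le j \le z_L - 1$, and $T_{m+2j} = 0$ for all $1 \le j \le z_L$; that is, the left edge of $T$ has the form $110101\ldots10$ containing $z_L$ zeros. Furthermore all these zeros lie at negative indices, since $-L + 2z_L \leq -\log_\varphi n - 3 < 0$.
   Context: The Bergman Game: a state is a function $a:\mathbb{Z}\to\mathbb{Z}_{\geq 0}$ with finite support; $a_i$ is the number of chips (summands) at index $i$. A combine at index $i$ is available if $a_i \geq 1$ and $a_{i+1} \geq 1$; it decreases $a_i$ and $a_{i+1}$ by $1$ each and increases $a_{i+2}$ by $1$. A split at index $i$ is available if $a_i \geq 2$; it decreases $a_i$ by $2$ and increases each of $a_{i+1}$ and $a_{i-2}$ by $1$. The state ${}_0(n)$ has $n$ chips at index $0$ and none elsewhere. -}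

module Defs where

open import Data.Nat using (ℕ; zero; suc; _*_; _∸_; _^_; _≤_)
import Data.Nat as ℕ
open import Data.Integer using (ℤ; +_; _-_; _≟_)
import Data.Integer as ℤ
open import Relation.Nullary using (yes; no)
open import Relation.Binary.PropositionalEquality using (_≡_)
open import Relation.Binary.Construct.Closure.ReflexiveTransitive using (Star)
open import Data.Product using (_×_)

-- A state of the Bergman Game: a_i chips at index i.  (States reachable from
-- the finitely supported initial state automatically have finite support.)
State : Set
State = ℤ → ℕ

δ : ℤ → ℤ → ℕ
δ i j with i ≟ j
... | yes _ = 1
... | no  _ = 0

init : ℕ → State
init n j = n * δ (+ 0) j

Combine : ℤ → State → State → Set
Combine i a b =
  (1 ≤ a i) × (1 ≤ a (i ℤ.+ + 1)) ×
  (∀ j → b j ℕ.+ δ i j ℕ.+ δ (i ℤ.+ + 1) j ≡ a j ℕ.+ δ (i ℤ.+ + 2) j)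

Split : ℤ → State → State → Set
Split i a b =
  (2 ≤ a i) ×
  (∀ j → b j ℕ.+ 2 * δ i j ≡ a j ℕ.+ δ (i ℤ.+ + 1) j ℕ.+ δ (i - + 2) j)

data Move (a b : State) : Set where
  combine : (i : ℤ) → Combine i a b → Move a b
  split   : (i : ℤ) → Split i a b → Move a b

Reachable : State → State → Set
Reachable = Star Move

-- Fibonacci and Lucas numbers: φ^k = (lucas k + fib k · √5) / 2
fib : ℕ → ℕ
fib zero = 0
fib (suc zero) = 1
fib (suc (suc k)) = fib (suc k) ℕ.+ fib k

lucas : ℕ → ℕ
lucas zero = 2
lucas (suc zero) = 1
lucas (suc (suc k)) = lucas (suc k) ℕ.+ lucas k

-- n ≤ φ^k, i.e. log_φ n ≤ k, decided exactly:
-- 2n ≤ L_k + F_k √5  ⇔  (2n ∸ L_k)² ≤ 5 F_k²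
n≤φ^ : ℕ → ℕ → Set
n≤φ^ n k = (2 * n ∸ lucas k) ^ 2 ≤ 5 * fib k ^ 2

-- Let w : ℤ → ℤ satisfy w (j + 2) = w (j + 1) + w j.  A combine at i trades w i + w (i + 1) for
-- w (i + 2) and a split trades 2 w i for w (i + 1) + w (i - 2), so the weight Σⱼ aⱼ wⱼ of a state
-- is invariant and equals n w₀ on every state reachable from ₀(n): an integer form of Σⱼ aⱼ φʲ = n.
--
-- Take wⱼ = F_{j-c}, with F the Fibonacci numbers extended to negative indices and c = m + 2K + 1
-- so large that all chips lie in [m, c).  On this window the weights alternate in sign,
-- F_{2K+1}, -F_{2K}, F_{2K-1}, …, and the total n F_{-c} is at most F_{k+2} F_c ≤ F_{2r-1}, where
-- K = z + r.  A 0/1 string of even length 2R weighs at least -F_{2R+1}, so after the leading 1 at m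
-- each of the next z pairs of digits must be 1 0: a 0, or a pair 1 1, would leave a total of at
-- least F_{2R+1} > F_{2r-1}, where 2R + 1 ≥ 2r + 1 positions follow the pair.

module Submission where

open import Defs
open import Data.Nat using (ℕ; zero; suc; z≤n; s≤s; _≤_; _<_; _∸_)
import Data.Nat as ℕ
import Data.Nat.Properties as ℕP
import Data.Nat.Tactic.RingSolver as ℕ-Solver
open import Data.Integer using (ℤ; +_; -[1+_]; -_; _+_; _*_; _-_; 0ℤ; +≤+; +<+; _≟_)
import Data.Integer as ℤ
import Data.Integer.Properties as ℤP
open import Data.Integer.Tactic.RingSolver using (solve-∀)
open import Algebra.Properties.AbelianGroup ℤP.+-0-abelianGroup using (∙-cancelˡ; ∙-cancelʳ)
open import Data.Product using (∃-syntax; _×_; _,_; proj₁; proj₂)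
open import Data.Sum using (_⊎_; inj₁; inj₂)
open import Relation.Nullary using (¬_; yes; no; contradiction)
open import Relation.Binary.PropositionalEquality
open import Relation.Binary.Construct.Closure.ReflexiveTransitive using (ε; _◅_)

δ-refl : ∀ i → δ i i ≡ 1
δ-refl i with i ≟ i
... | yes _   = refl
... | no  i≢i = contradiction refl i≢i

δ-≢ : ∀ {i j} → i ≢ j → δ i j ≡ 0
δ-≢ {i} {j} i≢j with i ≟ j
... | yes i≡j = contradiction i≡j i≢j
... | no  _   = refl

δ>0⇒≡ : ∀ {i j} → 0 < δ i j → i ≡ j
δ>0⇒≡ {i} {j} δ>0 with i ≟ j
... | yes i≡j = i≡j
... | no  _   = contradiction δ>0 λ ()

m+n>0⇒m>0∨n>0 : ∀ m {n} → 0 < m ℕ.+ n → 0 < m ⊎ 0 < n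
m+n>0⇒m>0∨n>0 zero    n>0 = inj₂ n>0
m+n>0⇒m>0∨n>0 (suc m) _   = inj₁ (s≤s z≤n)

m*n>0⇒n>0 : ∀ m {n} → 0 < m ℕ.* n → 0 < n
m*n>0⇒n>0 m {zero}  m*0>0 = contradiction (ℕP.*-zeroʳ m) (ℕP.>⇒≢ m*0>0)
m*n>0⇒n>0 m {suc n} _     = s≤s z≤n

i+m+n≡i+[m+n] : ∀ lo s t → lo + + s + + t ≡ lo + + (s ℕ.+ t)
i+m+n≡i+[m+n] lo s t = trans (ℤP.+-assoc lo (+ s) (+ t)) (cong (_+_ lo) (sym (ℤP.pos-+ s t)))

i+m≡i+n⇒m≡n : ∀ lo {s t} → lo + + s ≡ lo + + t → s ≡ t
i+m≡i+n⇒m≡n lo eq = ℤP.+-injective (∙-cancelˡ lo _ _ eq)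

+2*+j≡+[j*2] : ∀ j → + 2 * + j ≡ + (j ℕ.* 2)
+2*+j≡+[j*2] j = trans (sym (ℤP.pos-* 2 j)) (cong +_ (ℕP.*-comm 2 j))

∑ : ℤ → ℕ → (ℤ → ℤ) → ℤ
∑ lo zero    g = 0ℤ
∑ lo (suc l) g = g lo + ∑ (lo + + 1) l g

∑-cong : ∀ lo l {g h : ℤ → ℤ} → (∀ j → g j ≡ h j) → ∑ lo l g ≡ ∑ lo l h
∑-cong lo zero    g≡h = refl
∑-cong lo (suc l) g≡h = cong₂ _+_ (g≡h lo) (∑-cong (lo + + 1) l g≡h)

∑-+ : ∀ lo l (g h : ℤ → ℤ) → ∑ lo l (λ j → g j + h j) ≡ ∑ lo l g + ∑ lo l h
∑-+ lo zero    g h = refl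
∑-+ lo (suc l) g h = begin
  g lo + h lo + ∑ (lo + + 1) l (λ j → g j + h j)
    ≡⟨ cong (_+_ (g lo + h lo)) (∑-+ (lo + + 1) l g h) ⟩
  g lo + h lo + (∑ (lo + + 1) l g + ∑ (lo + + 1) l h)
    ≡⟨ interchange (g lo) (h lo) _ _ ⟩
  g lo + ∑ (lo + + 1) l g + (h lo + ∑ (lo + + 1) l h) ∎
  where
  open ≡-Reasoning
  interchange : ∀ a b c d → a + b + (c + d) ≡ a + c + (b + d)
  interchange = solve-∀

∑-*ˡ : ∀ lo l c (g : ℤ → ℤ) → ∑ lo l (λ j → c * g j) ≡ c * ∑ lo l g
∑-*ˡ lo zero    c g = sym (ℤP.*-zeroʳ c)
∑-*ˡ lo (suc l) c g = trans (cong (_+_ (c * g lo)) (∑-*ˡ (lo + + 1) l c g))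
                            (sym (ℤP.*-distribˡ-+ c (g lo) _))

∑-++ : ∀ lo p q (g : ℤ → ℤ) → ∑ lo (p ℕ.+ q) g ≡ ∑ lo p g + ∑ (lo + + p) q g
∑-++ lo zero    q g = trans (cong (λ x → ∑ x q g) (sym (ℤP.+-identityʳ lo))) (sym (ℤP.+-identityˡ _))
∑-++ lo (suc p) q g = begin
  g lo + ∑ (lo + + 1) (p ℕ.+ q) g
    ≡⟨ cong (_+_ (g lo)) (∑-++ (lo + + 1) p q g) ⟩
  g lo + (∑ (lo + + 1) p g + ∑ (lo + + 1 + + p) q g)
    ≡⟨ sym (ℤP.+-assoc (g lo) _ _) ⟩
  g lo + ∑ (lo + + 1) p g + ∑ (lo + + 1 + + p) q g
    ≡⟨ cong (λ x → g lo + ∑ (lo + + 1) p g + ∑ x q g) (i+m+n≡i+[m+n] lo 1 p) ⟩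
  g lo + ∑ (lo + + 1) p g + ∑ (lo + + suc p) q g ∎
  where open ≡-Reasoning

∑-vanish : ∀ lo l (g : ℤ → ℤ) → (∀ t → t < l → g (lo + + t) ≡ 0ℤ) → ∑ lo l g ≡ 0ℤ
∑-vanish lo zero    g g≡0 = refl
∑-vanish lo (suc l) g g≡0 = cong₂ _+_
  (trans (cong g (sym (ℤP.+-identityʳ lo))) (g≡0 0 (s≤s z≤n)))
  (∑-vanish (lo + + 1) l g λ t t<l → trans (cong g (i+m+n≡i+[m+n] lo 1 t)) (g≡0 (suc t) (s≤s t<l)))

InWindow : ℤ → ℕ → ℤ → Set
InWindow lo l i = ∃[ t ] t < l × i ≡ lo + + t

SupportedIn : State → ℤ → ℕ → Set
SupportedIn a lo l = ∀ i → 0 < a i → InWindow lo l i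

outside-vanishes : ∀ {a lo l j} → SupportedIn a lo l → ¬ InWindow lo l j → a j ≡ 0
outside-vanishes {j = j} supp j∉ = ℕP.n≤0⇒n≡0 (ℕP.≮⇒≥ λ aj>0 → j∉ (supp j aj>0))

weight : (ℤ → ℤ) → State → ℤ → ℕ → ℤ
weight w a lo l = ∑ lo l (λ j → + a j * w j)

module _ (w : ℤ → ℤ) where

  open ≡-Reasoning

  weight-cong : ∀ {a b} lo l → (∀ j → a j ≡ b j) → weight w a lo l ≡ weight w b lo l
  weight-cong lo l a≡b = ∑-cong lo l λ j → cong (λ n → + n * w j) (a≡b j)

  weight-+ : ∀ a b lo l → weight w (λ j → a j ℕ.+ b j) lo l ≡ weight w a lo l + weight w b lo l
  weight-+ a b lo l = trans
    (∑-cong lo l λ j → trans (cong (_* w j) (ℤP.pos-+ (a j) (b j))) (ℤP.*-distribʳ-+ (w j) (+ a j) (+ b j)))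
    (∑-+ lo l _ _)

  weight-*ˡ : ∀ k a lo l → weight w (λ j → k ℕ.* a j) lo l ≡ + k * weight w a lo l
  weight-*ˡ k a lo l = trans
    (∑-cong lo l λ j → trans (cong (_* w j) (ℤP.pos-* k (a j))) (ℤP.*-assoc (+ k) (+ a j) (w j)))
    (∑-*ˡ lo l (+ k) _)

  weight-δ : ∀ {lo l i} → InWindow lo l i → weight w (δ i) lo l ≡ w i
  weight-δ {lo} {suc l} {i} (zero , _ , i≡lo+0) = begin
    + δ i lo * w lo + weight w (δ i) (lo + + 1) l  ≡⟨ cong₂ _+_ (cong (λ n → + n * w lo) δ≡1) rest≡0 ⟩
    + 1 * w lo + 0ℤ                                ≡⟨ trans (ℤP.+-identityʳ _) (ℤP.*-identityˡ (w lo)) ⟩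
    w lo                                           ≡⟨ cong w (sym i≡lo) ⟩
    w i                                            ∎
    where
    i≡lo : i ≡ lo
    i≡lo = trans i≡lo+0 (ℤP.+-identityʳ lo)
    δ≡1 : δ i lo ≡ 1
    δ≡1 = trans (cong (λ x → δ x lo) i≡lo) (δ-refl lo)
    rest≡0 : weight w (δ i) (lo + + 1) l ≡ 0ℤ
    rest≡0 = ∑-vanish _ l _ λ t _ → cong (λ n → + n * w _) (δ-≢ λ i≡ →
      ℕP.0≢1+n (i+m≡i+n⇒m≡n lo (trans (sym i≡lo+0) (trans i≡ (i+m+n≡i+[m+n] lo 1 t)))))
  weight-δ {lo} {suc l} {i} (suc t , s≤s t<l , i≡) = begin
    + δ i lo * w lo + weight w (δ i) (lo + + 1) l
      ≡⟨ cong₂ _+_ (cong (λ n → + n * w lo) (δ-≢ i≢lo))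
                   (weight-δ (t , t<l , trans i≡ (sym (i+m+n≡i+[m+n] lo 1 t)))) ⟩
    0ℤ + w i
      ≡⟨ ℤP.+-identityˡ (w i) ⟩
    w i ∎
    where
    i≢lo : i ≢ lo
    i≢lo i≡lo = ℕP.1+n≢0 (i+m≡i+n⇒m≡n lo (trans (sym i≡) (trans i≡lo (sym (ℤP.+-identityʳ lo)))))

  weight-extend : ∀ {a} lo p l q → SupportedIn a (lo + + p) l →
                  weight w a lo (p ℕ.+ l ℕ.+ q) ≡ weight w a (lo + + p) l
  weight-extend {a} lo p l q supp = begin
    weight w a lo (p ℕ.+ l ℕ.+ q)
      ≡⟨ ∑-++ lo (p ℕ.+ l) q _ ⟩
    weight w a lo (p ℕ.+ l) + weight w a (lo + + (p ℕ.+ l)) q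
      ≡⟨ cong₂ _+_ (∑-++ lo p l _) right≡0 ⟩
    weight w a lo p + weight w a (lo + + p) l + 0ℤ
      ≡⟨ cong (λ x → x + weight w a (lo + + p) l + 0ℤ) left≡0 ⟩
    0ℤ + weight w a (lo + + p) l + 0ℤ
      ≡⟨ trans (ℤP.+-identityʳ _) (ℤP.+-identityˡ _) ⟩
    weight w a (lo + + p) l ∎
    where
    vanish : ∀ j → ¬ InWindow (lo + + p) l j → + a j * w j ≡ 0ℤ
    vanish j j∉ = cong (λ n → + n * w j) (outside-vanishes {lo = lo + + p} {l} supp j∉)
    left≡0 : weight w a lo p ≡ 0ℤ
    left≡0 = ∑-vanish lo p _ λ t t<p → vanish _ λ (t' , _ , eq) →
      ℕP.<⇒≱ t<p (ℕP.≤-trans (ℕP.m≤m+n p t')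
        (ℕP.≤-reflexive (sym (i+m≡i+n⇒m≡n lo (trans eq (i+m+n≡i+[m+n] lo p t'))))))
    right≡0 : weight w a (lo + + (p ℕ.+ l)) q ≡ 0ℤ
    right≡0 = ∑-vanish _ q _ λ t _ → vanish _ λ (t' , t'<l , eq) →
      ℕP.<⇒≱ t'<l (ℕP.+-cancelˡ-≤ p l t' (ℕP.≤-trans (ℕP.m≤m+n (p ℕ.+ l) t)
        (ℕP.≤-reflexive (i+m≡i+n⇒m≡n lo (begin
          lo + + (p ℕ.+ l ℕ.+ t)     ≡⟨ sym (i+m+n≡i+[m+n] lo (p ℕ.+ l) t) ⟩
          lo + + (p ℕ.+ l) + + t     ≡⟨ eq ⟩
          lo + + p + + t'            ≡⟨ i+m+n≡i+[m+n] lo p t' ⟩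
          lo + + (p ℕ.+ t')          ∎)))))

FibonacciLike : (ℤ → ℤ) → Set
FibonacciLike w = ∀ j → w (j + + 2) ≡ w (j + + 1) + w j

split-balanced : ∀ {w} → FibonacciLike w → ∀ i → w (i + + 1) + w (i - + 2) ≡ + 2 * w i
split-balanced {w} rec i = begin
  w (i + + 1) + w u                        ≡⟨ cong (λ x → w x + w u) (i+1≡u+1+2 i) ⟩
  w (u + + 1 + + 2) + w u                  ≡⟨ cong (_+ w u) (rec (u + + 1)) ⟩
  w (u + + 1 + + 1) + w (u + + 1) + w u    ≡⟨ cong (λ x → w x + w (u + + 1) + w u) (ℤP.+-assoc u (+ 1) (+ 1)) ⟩
  w (u + + 2) + w (u + + 1) + w u          ≡⟨ ℤP.+-assoc (w (u + + 2)) _ _ ⟩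
  w (u + + 2) + (w (u + + 1) + w u)        ≡⟨ cong (_+_ (w (u + + 2))) (sym (rec u)) ⟩
  w (u + + 2) + w (u + + 2)                ≡⟨ x+x≡2x (w (u + + 2)) ⟩
  + 2 * w (u + + 2)                        ≡⟨ cong (λ x → + 2 * w x) (u+2≡i i) ⟩
  + 2 * w i                                ∎
  where
  open ≡-Reasoning
  u = i - + 2
  i+1≡u+1+2 : ∀ i → i + + 1 ≡ i - + 2 + + 1 + + 2
  i+1≡u+1+2 = solve-∀
  u+2≡i : ∀ i → i - + 2 + + 2 ≡ i
  u+2≡i = solve-∀
  x+x≡2x : ∀ x → x + x ≡ + 2 * x
  x+x≡2x = solve-∀

δ-supported : ∀ lo l {k} → InWindow lo l k → SupportedIn (δ k) lo l
δ-supported lo l k∈ j δ>0 = subst (InWindow lo l) (δ>0⇒≡ δ>0) k∈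

+-supported : ∀ {a b} lo l → SupportedIn a lo l → SupportedIn b lo l → SupportedIn (λ j → a j ℕ.+ b j) lo l
+-supported {a} lo l supp-a supp-b j a+b>0 with m+n>0⇒m>0∨n>0 (a j) a+b>0
... | inj₁ aj>0 = supp-a j aj>0
... | inj₂ bj>0 = supp-b j bj>0

exchange-supported : ∀ {a b removed added : State} lo l → (∀ j → b j ℕ.+ removed j ≡ a j ℕ.+ added j) →
                     SupportedIn a lo l → SupportedIn added lo l → SupportedIn b lo l
exchange-supported {a} {b} {removed} {added} lo l exchange supp-a supp-added j bj>0 =
  +-supported {a} {added} lo l supp-a supp-added j
    (subst (0 <_) (exchange j) (ℕP.<-≤-trans bj>0 (ℕP.m≤m+n (b j) (removed j))))

exchange-weight : ∀ w {a b removed added : State} lo l → (∀ j → b j ℕ.+ removed j ≡ a j ℕ.+ added j) →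
                  weight w removed lo l ≡ weight w added lo l → weight w b lo l ≡ weight w a lo l
exchange-weight w {a} {b} {removed} {added} lo l exchange balanced = ∙-cancelʳ (weight w removed lo l) _ _ (begin
  weight w b lo l + weight w removed lo l          ≡⟨ sym (weight-+ w b removed lo l) ⟩
  weight w (λ j → b j ℕ.+ removed j) lo l         ≡⟨ weight-cong w lo l exchange ⟩
  weight w (λ j → a j ℕ.+ added j) lo l           ≡⟨ weight-+ w a added lo l ⟩
  weight w a lo l + weight w added lo l           ≡⟨ cong (_+_ (weight w a lo l)) (sym balanced) ⟩
  weight w a lo l + weight w removed lo l         ∎)
  where open ≡-Reasoning

widen : ∀ lo l {i} → InWindow lo l i → ∀ e → e ≤ 4 → ∀ {j} → i - + 2 + + e ≡ j →
        InWindow (lo - + 2) (2 ℕ.+ l ℕ.+ 2) j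
widen lo l (t , t<l , refl) e e≤4 refl = t ℕ.+ e , t+e<l+4 , trans (shift lo (+ t) (+ e)) (i+m+n≡i+[m+n] (lo - + 2) t e)
  where
  t+e<l+4 : t ℕ.+ e < 2 ℕ.+ l ℕ.+ 2
  t+e<l+4 = ℕP.<-≤-trans (ℕP.+-mono-<-≤ t<l e≤4) (ℕP.≤-reflexive (l+4≡2+l+2 l))
    where
    l+4≡2+l+2 : ∀ l → l ℕ.+ 4 ≡ 2 ℕ.+ l ℕ.+ 2
    l+4≡2+l+2 = ℕ-Solver.solve-∀
  shift : ∀ lo t e → lo + t - + 2 + e ≡ lo - + 2 + t + e
  shift = solve-∀

module Neighbourhood lo l {i} (i∈window : InWindow lo l i) where

  i-2∈ : InWindow (lo - + 2) (2 ℕ.+ l ℕ.+ 2) (i - + 2)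
  i-2∈ = widen lo l i∈window 0 z≤n (ℤP.+-identityʳ (i - + 2))

  i∈ : InWindow (lo - + 2) (2 ℕ.+ l ℕ.+ 2) i
  i∈ = widen lo l i∈window 2 (ℕP.m≤m+n 2 2) (eq i)
    where
    eq : ∀ i → i - + 2 + + 2 ≡ i
    eq = solve-∀

  i+1∈ : InWindow (lo - + 2) (2 ℕ.+ l ℕ.+ 2) (i + + 1)
  i+1∈ = widen lo l i∈window 3 (ℕP.m≤m+n 3 1) (eq i)
    where
    eq : ∀ i → i - + 2 + + 3 ≡ i + + 1
    eq = solve-∀

  i+2∈ : InWindow (lo - + 2) (2 ℕ.+ l ℕ.+ 2) (i + + 2)
  i+2∈ = widen lo l i∈window 4 ℕP.≤-refl (eq i)
    where
    eq : ∀ i → i - + 2 + + 4 ≡ i + + 2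
    eq = solve-∀

widen-supported : ∀ {a} lo l → SupportedIn a lo l → SupportedIn a (lo - + 2) (2 ℕ.+ l ℕ.+ 2)
widen-supported lo l supp j aj>0 = Neighbourhood.i∈ lo l (supp j aj>0)

move-supported : ∀ {a b} lo l → SupportedIn a lo l → Move a b → SupportedIn b (lo - + 2) (2 ℕ.+ l ℕ.+ 2)
move-supported {a} {b} lo l supp (combine i (ai>0 , _ , moved)) =
  exchange-supported (lo - + 2) _ (λ j → trans (sym (ℕP.+-assoc (b j) _ _)) (moved j))
    (widen-supported lo l supp) (δ-supported (lo - + 2) _ i+2∈)
  where open Neighbourhood lo l (supp i ai>0)
move-supported {a} {b} lo l supp (split i (ai>1 , moved)) =
  exchange-supported (lo - + 2) _ (λ j → trans (moved j) (ℕP.+-assoc (a j) _ _))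
    (widen-supported lo l supp)
    (+-supported (lo - + 2) _ (δ-supported (lo - + 2) _ i+1∈) (δ-supported (lo - + 2) _ i-2∈))
  where open Neighbourhood lo l (supp i (ℕP.<-≤-trans (s≤s z≤n) ai>1))

move-weight : ∀ {w} → FibonacciLike w → ∀ {a b} lo l → SupportedIn a lo l → Move a b →
              weight w b (lo - + 2) (2 ℕ.+ l ℕ.+ 2) ≡ weight w a (lo - + 2) (2 ℕ.+ l ℕ.+ 2)
move-weight {w} rec {a} {b} lo l supp (combine i (ai>0 , _ , moved)) =
  exchange-weight w {a} {b} lo' L (λ j → trans (sym (ℕP.+-assoc (b j) _ _)) (moved j)) (begin
    weight w (λ j → δ i j ℕ.+ δ (i + + 1) j) lo' L  ≡⟨ weight-+ w (δ i) (δ (i + + 1)) lo' L ⟩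
    weight w (δ i) lo' L + weight w (δ (i + + 1)) lo' L
                                                   ≡⟨ cong₂ _+_ (weight-δ w i∈) (weight-δ w i+1∈) ⟩
    w i + w (i + + 1)                              ≡⟨ trans (ℤP.+-comm (w i) _) (sym (rec i)) ⟩
    w (i + + 2)                                    ≡⟨ sym (weight-δ w i+2∈) ⟩
    weight w (δ (i + + 2)) lo' L                   ∎)
  where
  open ≡-Reasoning
  open Neighbourhood lo l (supp i ai>0)
  lo' = lo - + 2
  L = 2 ℕ.+ l ℕ.+ 2
move-weight {w} rec {a} {b} lo l supp (split i (ai>1 , moved)) =
  exchange-weight w {a} {b} lo' L (λ j → trans (moved j) (ℕP.+-assoc (a j) _ _)) (begin
    weight w (λ j → 2 ℕ.* δ i j) lo' L              ≡⟨ weight-*ˡ w 2 (δ i) lo' L ⟩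
    + 2 * weight w (δ i) lo' L                     ≡⟨ cong (+ 2 *_) (weight-δ w i∈) ⟩
    + 2 * w i                                      ≡⟨ sym (split-balanced rec i) ⟩
    w (i + + 1) + w (i - + 2)                      ≡⟨ sym (cong₂ _+_ (weight-δ w i+1∈) (weight-δ w i-2∈)) ⟩
    weight w (δ (i + + 1)) lo' L + weight w (δ (i - + 2)) lo' L
                                                   ≡⟨ sym (weight-+ w (δ (i + + 1)) (δ (i - + 2)) lo' L) ⟩
    weight w (λ j → δ (i + + 1) j ℕ.+ δ (i - + 2) j) lo' L ∎)
  where
  open ≡-Reasoning
  open Neighbourhood lo l (supp i (ℕP.<-≤-trans (s≤s z≤n) ai>1))
  lo' = lo - + 2
  L = 2 ℕ.+ l ℕ.+ 2

weight-extendʳ : ∀ w {a} lo l q → SupportedIn a lo l → weight w a lo (l ℕ.+ q) ≡ weight w a lo l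
weight-extendʳ w {a} lo l q supp =
  trans (weight-extend w lo 0 l q (subst (λ x → SupportedIn a x l) (sym (ℤP.+-identityʳ lo)) supp))
        (cong (λ x → weight w a x l) (ℤP.+-identityʳ lo))

weight-shift-window : ∀ w {a} lo t l → SupportedIn a lo l → SupportedIn a (lo + + t) l →
                      weight w a (lo + + t) l ≡ weight w a lo l
weight-shift-window w {a} lo t l supp supp-t = begin
  weight w a (lo + + t) l          ≡⟨ sym (weight-extend w lo t l 0 supp-t) ⟩
  weight w a lo (t ℕ.+ l ℕ.+ 0)   ≡⟨ cong (weight w a lo) (t+l+0≡l+t t l) ⟩
  weight w a lo (l ℕ.+ t)          ≡⟨ weight-extendʳ w lo l t supp ⟩
  weight w a lo l                  ∎
  where
  open ≡-Reasoning
  t+l+0≡l+t : ∀ t l → t ℕ.+ l ℕ.+ 0 ≡ l ℕ.+ t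
  t+l+0≡l+t = ℕ-Solver.solve-∀

HasFibValue : ℕ → State → Set
HasFibValue n a = ∃[ lo ] ∃[ l ] SupportedIn a lo l × (∀ w → FibonacciLike w → weight w a lo l ≡ + n * w 0ℤ)

init-hasFibValue : ∀ n → HasFibValue n (init n)
init-hasFibValue n =
  0ℤ , 1 , supp , λ w _ → trans (weight-*ˡ w n (δ 0ℤ) 0ℤ 1) (cong (+ n *_) (weight-δ w {0ℤ} {1} 0∈))
  where
  0∈ : InWindow 0ℤ 1 0ℤ
  0∈ = 0 , s≤s z≤n , refl
  supp : SupportedIn (init n) 0ℤ 1
  supp j nδ>0 = δ-supported 0ℤ 1 0∈ j (m*n>0⇒n>0 n nδ>0)

move-hasFibValue : ∀ {n a b} → Move a b → HasFibValue n a → HasFibValue n b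
move-hasFibValue {n} {a} {b} mv (lo , l , supp , value) =
  lo - + 2 , 2 ℕ.+ l ℕ.+ 2 , move-supported lo l supp mv , λ w rec → begin
    weight w b (lo - + 2) (2 ℕ.+ l ℕ.+ 2)   ≡⟨ move-weight rec lo l supp mv ⟩
    weight w a (lo - + 2) (2 ℕ.+ l ℕ.+ 2)   ≡⟨ weight-extend w (lo - + 2) 2 l 2 supp′ ⟩
    weight w a (lo - + 2 + + 2) l           ≡⟨ cong (λ x → weight w a x l) (lo-2+2≡lo lo) ⟩
    weight w a lo l                         ≡⟨ value w rec ⟩
    + n * w 0ℤ                              ∎
  where
  open ≡-Reasoning
  lo-2+2≡lo : ∀ lo → lo - + 2 + + 2 ≡ lo
  lo-2+2≡lo = solve-∀
  supp′ : SupportedIn a (lo - + 2 + + 2) l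
  supp′ = subst (λ x → SupportedIn a x l) (sym (lo-2+2≡lo lo)) supp

reachable-hasFibValue : ∀ {n a b} → Reachable a b → HasFibValue n a → HasFibValue n b
reachable-hasFibValue ε          v = v
reachable-hasFibValue {n} (mv ◅ mvs) v = reachable-hasFibValue {n} mvs (move-hasFibValue {n} mv v)

supported-from-leftmost : ∀ {a} lo l {m} → SupportedIn a lo l → 0 < a m → (∀ i → i ℤ.< m → a i ≡ 0) →
                          InWindow lo l m × SupportedIn a m l
supported-from-leftmost {a} lo l {m} supp am>0 left = supp m am>0 , from-m
  where
  from-m : SupportedIn a m l
  from-m j aj>0 with supp m am>0 | supp j aj>0
  ... | t₀ , _ , refl | t , t<l , refl with t₀ ℕP.≤? t
  ...   | yes t₀≤t = t ∸ t₀ , ℕP.≤-<-trans (ℕP.m∸n≤m t t₀) t<l ,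
          trans (cong (λ x → lo + + x) (sym (ℕP.m+[n∸m]≡n t₀≤t))) (sym (i+m+n≡i+[m+n] lo t₀ (t ∸ t₀)))
  ...   | no  t₀≰t =
          contradiction (left (lo + + t) (ℤP.+-monoʳ-< lo (ℤ.+<+ (ℕP.≰⇒> t₀≰t)))) (ℕP.>⇒≢ aj>0)

leftmost-window-value : ∀ {n a m} → Reachable (init n) a → 0 < a m → (∀ i → i ℤ.< m → a i ≡ 0) →
                        ∃[ l ] ∀ L → l ≤ L → ∀ w → FibonacciLike w → weight w a m L ≡ + n * w 0ℤ
leftmost-window-value {n} {a} reach am>0 left
  with reachable-hasFibValue {n} reach (init-hasFibValue n)
... | lo , l , supp , value with supported-from-leftmost lo l supp am>0 left
...   | (t₀ , _ , refl) , supp-m = l , λ L l≤L w rec → begin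
  weight w a (lo + + t₀) L              ≡⟨ cong (weight w a (lo + + t₀)) (ℕP.m+[n∸m]≡n l≤L) ⟨
  weight w a (lo + + t₀) (l ℕ.+ (L ∸ l)) ≡⟨ weight-extendʳ w (lo + + t₀) l (L ∸ l) supp-m ⟩
  weight w a (lo + + t₀) l              ≡⟨ weight-shift-window w lo t₀ l supp supp-m ⟩
  weight w a lo l                       ≡⟨ value w rec ⟩
  + n * w 0ℤ                            ∎
  where open ≡-Reasoning

fib-≤-suc : ∀ n → fib n ≤ fib (suc n)
fib-≤-suc zero    = z≤n
fib-≤-suc (suc n) = ℕP.m≤m+n (fib (suc n)) (fib n)

fib-mono : ∀ {m n} → m ≤ n → fib m ≤ fib n
fib-mono {n = zero}  z≤n    = ℕP.≤-refl
fib-mono {n = suc n} m≤1+n with ℕP.m≤n⇒m<n∨m≡n m≤1+n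
... | inj₁ m<1+n = ℕP.≤-trans (fib-mono (ℕP.m<1+n⇒m≤n m<1+n)) (fib-≤-suc n)
... | inj₂ refl  = ℕP.≤-refl

fib[1+n]<fib[3+n] : ∀ n → fib (suc n) < fib (3 ℕ.+ n)
fib[1+n]<fib[3+n] n = ℕP.+-monoˡ-≤ (fib (suc n)) (fib-mono {1} {2 ℕ.+ n} (s≤s z≤n))

fib[1+a]*fib[b]≤fib[a+b] : ∀ a b → fib (suc a) ℕ.* fib b ≤ fib (a ℕ.+ b)
fib[1+a]*fib[b]≤fib[a+b] a zero          =
  subst (_≤ fib (a ℕ.+ 0)) (sym (ℕP.*-zeroʳ (fib (suc a)))) z≤n
fib[1+a]*fib[b]≤fib[a+b] a (suc zero)    =
  ℕP.≤-reflexive (trans (ℕP.*-identityʳ (fib (suc a))) (cong fib (ℕP.+-comm 1 a)))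
fib[1+a]*fib[b]≤fib[a+b] a (suc (suc b)) = begin
  fib (suc a) ℕ.* (fib (suc b) ℕ.+ fib b)
    ≡⟨ ℕP.*-distribˡ-+ (fib (suc a)) (fib (suc b)) (fib b) ⟩
  fib (suc a) ℕ.* fib (suc b) ℕ.+ fib (suc a) ℕ.* fib b
    ≤⟨ ℕP.+-mono-≤ (fib[1+a]*fib[b]≤fib[a+b] a (suc b)) (fib[1+a]*fib[b]≤fib[a+b] a b) ⟩
  fib (a ℕ.+ suc b) ℕ.+ fib (a ℕ.+ b)
    ≡⟨ cong (λ i → fib i ℕ.+ fib (a ℕ.+ b)) (ℕP.+-suc a b) ⟩
  fib (2 ℕ.+ (a ℕ.+ b))
    ≡⟨ cong fib (trans (ℕP.+-suc a (suc b)) (cong suc (ℕP.+-suc a b))) ⟨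
  fib (a ℕ.+ suc (suc b)) ∎
  where open ℕP.≤-Reasoning

2*fib[2+k]≡lucas[k]+3*fib[k] : ∀ k → 2 ℕ.* fib (2 ℕ.+ k) ≡ lucas k ℕ.+ 3 ℕ.* fib k
2*fib[2+k]≡lucas[k]+3*fib[k] zero          = refl
2*fib[2+k]≡lucas[k]+3*fib[k] (suc zero)    = refl
2*fib[2+k]≡lucas[k]+3*fib[k] (suc (suc k)) = begin
  2 ℕ.* (fib (3 ℕ.+ k) ℕ.+ fib (2 ℕ.+ k))
    ≡⟨ ℕP.*-distribˡ-+ 2 (fib (3 ℕ.+ k)) (fib (2 ℕ.+ k)) ⟩
  2 ℕ.* fib (3 ℕ.+ k) ℕ.+ 2 ℕ.* fib (2 ℕ.+ k)
    ≡⟨ cong₂ ℕ._+_ (2*fib[2+k]≡lucas[k]+3*fib[k] (suc k)) (2*fib[2+k]≡lucas[k]+3*fib[k] k) ⟩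
  lucas (suc k) ℕ.+ 3 ℕ.* fib (suc k) ℕ.+ (lucas k ℕ.+ 3 ℕ.* fib k)
    ≡⟨ regroup (lucas (suc k)) (lucas k) (fib (suc k)) (fib k) ⟩
  lucas (suc k) ℕ.+ lucas k ℕ.+ 3 ℕ.* (fib (suc k) ℕ.+ fib k) ∎
  where
  open ≡-Reasoning
  regroup : ∀ a b c d → a ℕ.+ 3 ℕ.* c ℕ.+ (b ℕ.+ 3 ℕ.* d) ≡ a ℕ.+ b ℕ.+ 3 ℕ.* (c ℕ.+ d)
  regroup = ℕ-Solver.solve-∀

-- If n > F_{k+2} then 2n ∸ L_k ≥ 3F_k + 2, whose square exceeds 5F_k².
n≤φ^⇒n≤fib : ∀ {n} k → n≤φ^ n k → n ≤ fib (2 ℕ.+ k)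
n≤φ^⇒n≤fib {n} k n≤φᵏ with n ℕ.≤? fib (2 ℕ.+ k)
... | yes n≤fib = n≤fib
... | no  n≰fib = contradiction (ℕP.≤-trans (ℕP.^-monoˡ-≤ 2 3F+2≤2n∸L) n≤φᵏ) (ℕP.<⇒≱ 5F²<[3F+2]²)
  where
  F = fib k
  L = lucas k
  L+3F+2≤2n : L ℕ.+ (3 ℕ.* F ℕ.+ 2) ≤ 2 ℕ.* n
  L+3F+2≤2n = begin
    L ℕ.+ (3 ℕ.* F ℕ.+ 2)       ≡⟨ shuffle L F ⟩
    2 ℕ.+ (L ℕ.+ 3 ℕ.* F)       ≡⟨ cong (2 ℕ.+_) (2*fib[2+k]≡lucas[k]+3*fib[k] k) ⟨
    2 ℕ.+ 2 ℕ.* fib (2 ℕ.+ k)   ≡⟨ ℕP.*-suc 2 (fib (2 ℕ.+ k)) ⟨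
    2 ℕ.* suc (fib (2 ℕ.+ k))   ≤⟨ ℕP.*-monoʳ-≤ 2 (ℕP.≰⇒> n≰fib) ⟩
    2 ℕ.* n                     ∎
    where
    open ℕP.≤-Reasoning
    shuffle : ∀ L F → L ℕ.+ (3 ℕ.* F ℕ.+ 2) ≡ 2 ℕ.+ (L ℕ.+ 3 ℕ.* F)
    shuffle = ℕ-Solver.solve-∀
  3F+2≤2n∸L : 3 ℕ.* F ℕ.+ 2 ≤ 2 ℕ.* n ∸ L
  3F+2≤2n∸L = subst (_≤ 2 ℕ.* n ∸ L) (ℕP.m+n∸m≡n L _) (ℕP.∸-monoˡ-≤ L L+3F+2≤2n)
  square : ∀ F → (3 ℕ.* F ℕ.+ 2) ℕ.* ((3 ℕ.* F ℕ.+ 2) ℕ.* 1)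
               ≡ suc (5 ℕ.* (F ℕ.* (F ℕ.* 1)) ℕ.+ (4 ℕ.* (F ℕ.* F) ℕ.+ 12 ℕ.* F ℕ.+ 3))
  square = ℕ-Solver.solve-∀
  5F²<[3F+2]² : 5 ℕ.* F ℕ.^ 2 < (3 ℕ.* F ℕ.+ 2) ℕ.^ 2
  5F²<[3F+2]² = subst (5 ℕ.* F ℕ.^ 2 <_) (sym (square F)) (s≤s (ℕP.m≤m+n _ _))

negFib : ℕ → ℤ
negFib zero                = 0ℤ
negFib (suc zero)          = + 1
negFib (suc (suc n))       = negFib n - negFib (suc n)

fibℤ : ℤ → ℤ
fibℤ (+ n)    = + fib n
fibℤ -[1+ n ] = negFib (suc n)

fibℤ-fibonacciLike : FibonacciLike fibℤ
fibℤ-fibonacciLike (+ n) rewrite ℕP.+-comm n 2 | ℕP.+-comm n 1 = ℤP.pos-+ (fib (suc n)) (fib n)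
fibℤ-fibonacciLike -[1+ zero ]          = refl
fibℤ-fibonacciLike -[1+ suc zero ]      = refl
fibℤ-fibonacciLike -[1+ suc (suc n) ]   = a≡b+[a-b] (negFib (suc n)) (negFib (suc (suc n)))
  where
  a≡b+[a-b] : ∀ a b → a ≡ b + (a - b)
  a≡b+[a-b] = solve-∀

fibonacciLike-shift : ∀ {w} → FibonacciLike w → ∀ c → FibonacciLike (λ j → w (j - c))
fibonacciLike-shift {w} rec c j = begin
  w (j + + 2 - c)            ≡⟨ cong w (shift j c (+ 2)) ⟩
  w (j - c + + 2)            ≡⟨ rec (j - c) ⟩
  w (j - c + + 1) + w (j - c) ≡⟨ cong (λ i → w i + w (j - c)) (shift j c (+ 1)) ⟨
  w (j + + 1 - c) + w (j - c) ∎
  where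
  open ≡-Reasoning
  shift : ∀ j c d → j + d - c ≡ j - c + d
  shift = solve-∀

negFib-even : ∀ r → negFib (r ℕ.* 2) ≡ - + fib (r ℕ.* 2)
negFib-odd  : ∀ r → negFib (suc (r ℕ.* 2)) ≡ + fib (suc (r ℕ.* 2))
negFib-even zero    = refl
negFib-even (suc r) = begin
  negFib (r ℕ.* 2) - negFib (suc (r ℕ.* 2))       ≡⟨ cong₂ _-_ (negFib-even r) (negFib-odd r) ⟩
  - + fib (r ℕ.* 2) - + fib (suc (r ℕ.* 2))       ≡⟨ -a-b≡-[b+a] (+ fib (r ℕ.* 2)) _ ⟩
  - (+ fib (suc (r ℕ.* 2)) + + fib (r ℕ.* 2))     ≡⟨ cong -_ (ℤP.pos-+ (fib (suc (r ℕ.* 2))) _) ⟨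
  - + fib (suc r ℕ.* 2)                          ∎
  where
  open ≡-Reasoning
  -a-b≡-[b+a] : ∀ a b → - a - b ≡ - (b + a)
  -a-b≡-[b+a] = solve-∀
negFib-odd zero    = refl
negFib-odd (suc r) = begin
  negFib (suc (r ℕ.* 2)) - negFib (suc r ℕ.* 2)   ≡⟨ cong₂ _-_ (negFib-odd r) (negFib-even (suc r)) ⟩
  + fib (suc (r ℕ.* 2)) - - + fib (suc r ℕ.* 2)   ≡⟨ a--b≡b+a (+ fib (suc (r ℕ.* 2))) (+ fib (suc r ℕ.* 2)) ⟩
  + fib (suc r ℕ.* 2) + + fib (suc (r ℕ.* 2))     ≡⟨ ℤP.pos-+ (fib (suc r ℕ.* 2)) _ ⟨
  + fib (suc (suc r ℕ.* 2))                      ∎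
  where
  open ≡-Reasoning
  a--b≡b+a : ∀ a b → a - - b ≡ b + a
  a--b≡b+a = solve-∀

parity : ∀ n → ∃[ r ] (n ≡ r ℕ.* 2 ⊎ n ≡ suc (r ℕ.* 2))
parity zero    = 0 , inj₁ refl
parity (suc n) with parity n
... | r , inj₁ refl = r , inj₂ refl
... | r , inj₂ refl = suc r , inj₁ refl

negFib≤fib : ∀ s → negFib s ℤ.≤ + fib s
negFib≤fib s with parity s
... | r , inj₁ refl = subst (ℤ._≤ + fib (r ℕ.* 2)) (sym (negFib-even r)) ℤP.neg-≤-pos
... | r , inj₂ refl = ℤP.≤-reflexive (negFib-odd r)

fibℤ-neg : ∀ s → fibℤ (- + s) ≡ negFib s
fibℤ-neg zero    = refl
fibℤ-neg (suc s) = refl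

-- negFibSum x L = Σ_{t<L} x_t F_{t-L}, where negFib n = F_{-n}.
negFibSum : (ℕ → ℕ) → ℕ → ℤ
negFibSum x zero    = 0ℤ
negFibSum x (suc L) = + x 0 * negFib (suc L) + negFibSum (λ t → x (suc t)) L

weight-fibℤ≡negFibSum : ∀ a (x : ℕ → ℕ) lo L → (∀ t → a (lo + + t) ≡ x t) →
                        weight (λ j → fibℤ (j - (lo + + L))) a lo L ≡ negFibSum x L
weight-fibℤ≡negFibSum a x lo zero    _    = refl
weight-fibℤ≡negFibSum a x lo (suc L) a≡x = cong₂ _+_ head tail
  where
  open ≡-Reasoning
  head : + a lo * fibℤ (lo - (lo + + suc L)) ≡ + x 0 * negFib (suc L)
  head = cong₂ (λ n i → + n * fibℤ i) (trans (cong a (sym (ℤP.+-identityʳ lo))) (a≡x 0)) (lo-[lo+s]≡-s lo (+ suc L))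
    where
    lo-[lo+s]≡-s : ∀ lo s → lo - (lo + s) ≡ - s
    lo-[lo+s]≡-s = solve-∀
  tail : weight (λ j → fibℤ (j - (lo + + suc L))) a (lo + + 1) L ≡ negFibSum (λ t → x (suc t)) L
  tail = begin
    weight (λ j → fibℤ (j - (lo + + suc L))) a (lo + + 1) L
      ≡⟨ cong (λ c → weight (λ j → fibℤ (j - c)) a (lo + + 1) L) (i+m+n≡i+[m+n] lo 1 L) ⟨
    weight (λ j → fibℤ (j - (lo + + 1 + + L))) a (lo + + 1) L
      ≡⟨ weight-fibℤ≡negFibSum a _ (lo + + 1) L (λ t → trans (cong a (i+m+n≡i+[m+n] lo 1 t)) (a≡x (suc t))) ⟩
    negFibSum (λ t → x (suc t)) L ∎

negFibSum-pair : ∀ R y → negFibSum y (suc R ℕ.* 2) ≡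
  + y 0 * - + fib (suc R ℕ.* 2) + (+ y 1 * + fib (suc (R ℕ.* 2)) + negFibSum (λ t → y (2 ℕ.+ t)) (R ℕ.* 2))
negFibSum-pair R y = cong₂ (λ u v → + y 0 * u + (+ y 1 * v + negFibSum (λ t → y (2 ℕ.+ t)) (R ℕ.* 2)))
                           (negFib-even (suc R)) (negFib-odd R)

bit*[-F]≥-F : ∀ {x} F → x ≤ 1 → - + F ℤ.≤ + x * - + F
bit*[-F]≥-F F z≤n       = ℤP.neg-≤-pos
bit*[-F]≥-F F (s≤s z≤n) = ℤP.≤-reflexive (sym (ℤP.*-identityˡ (- + F)))

+m*+n≥0 : ∀ x F → 0ℤ ℤ.≤ + x * + F
+m*+n≥0 x F = subst (0ℤ ℤ.≤_) (ℤP.pos-* x F) (+≤+ z≤n)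

negFibSum-even-≥ : ∀ R y → (∀ t → y t ≤ 1) → - + fib (suc (R ℕ.* 2)) ℤ.≤ negFibSum y (R ℕ.* 2)
negFibSum-even-≥ zero    y y≤1 = ℤP.neg-≤-pos
negFibSum-even-≥ (suc R) y y≤1 = begin
  - + (Fe ℕ.+ Fo)                      ≡⟨ trans (cong -_ (ℤP.pos-+ Fe Fo)) (ℤP.neg-distrib-+ (+ Fe) (+ Fo)) ⟩
  - + Fe + - + Fo                      ≡⟨ cong (_+_ (- + Fe)) (ℤP.+-identityˡ (- + Fo)) ⟨
  - + Fe + (0ℤ + - + Fo)               ≤⟨ ℤP.+-mono-≤ (bit*[-F]≥-F Fe (y≤1 0)) (ℤP.+-mono-≤ (+m*+n≥0 (y 1) Fo)
                                            (negFibSum-even-≥ R _ (λ t → y≤1 (2 ℕ.+ t)))) ⟩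
  + y 0 * - + Fe + (+ y 1 * + Fo + negFibSum (λ t → y (2 ℕ.+ t)) (R ℕ.* 2))
                                       ≡⟨ negFibSum-pair R y ⟨
  negFibSum y (suc R ℕ.* 2)            ∎
  where
  open ℤP.≤-Reasoning
  Fe = fib (suc R ℕ.* 2)
  Fo = fib (suc (R ℕ.* 2))

pair-forced : ∀ {x₀ x₁} Fe Fo S → x₀ ≤ 1 → x₁ ≤ 1 → Fo ≤ Fe → - + Fo ℤ.≤ S →
  + (Fe ℕ.+ Fo) + (+ x₀ * - + Fe + (+ x₁ * + Fo + S)) ℤ.< + Fo →
  x₀ ≡ 1 × x₁ ≡ 0 × + (Fe ℕ.+ Fo) + (+ x₀ * - + Fe + (+ x₁ * + Fo + S)) ≡ + Fo + S
pair-forced {x₁ = x₁} Fe Fo S z≤n _ Fo≤Fe S≥-Fo V<Fo = contradiction V<Fo (ℤP.≤⇒≯ (begin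
  + Fo                                         ≤⟨ +≤+ Fo≤Fe ⟩
  + Fe                                         ≡⟨ eq (+ Fe) (+ Fo) ⟩
  + Fe + + Fo + (0ℤ + (0ℤ + - + Fo))           ≡⟨ cong (_+ (0ℤ + (0ℤ + - + Fo))) (ℤP.pos-+ Fe Fo) ⟨
  + (Fe ℕ.+ Fo) + (0ℤ + (0ℤ + - + Fo))         ≤⟨ ℤP.+-monoʳ-≤ (+ (Fe ℕ.+ Fo)) (ℤP.+-monoʳ-≤ 0ℤ
                                                    (ℤP.+-mono-≤ (+m*+n≥0 x₁ Fo) S≥-Fo)) ⟩
  + (Fe ℕ.+ Fo) + (0ℤ + (+ x₁ * + Fo + S))     ∎))
  where
  open ℤP.≤-Reasoning
  eq : ∀ a b → a ≡ a + b + (0ℤ + (0ℤ + - b))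
  eq = solve-∀
pair-forced Fe Fo S (s≤s z≤n) (s≤s z≤n) _ S≥-Fo V<Fo = contradiction V<Fo (ℤP.≤⇒≯ (begin
  + Fo                                         ≡⟨ eq (+ Fe) (+ Fo) ⟩
  + Fe + + Fo + (+ 1 * - + Fe + (+ 1 * + Fo + - + Fo))
                                               ≡⟨ cong (_+ (+ 1 * - + Fe + (+ 1 * + Fo + - + Fo))) (ℤP.pos-+ Fe Fo) ⟨
  + (Fe ℕ.+ Fo) + (+ 1 * - + Fe + (+ 1 * + Fo + - + Fo))
                                               ≤⟨ ℤP.+-monoʳ-≤ (+ (Fe ℕ.+ Fo)) (ℤP.+-monoʳ-≤ (+ 1 * - + Fe)
                                                    (ℤP.+-monoʳ-≤ (+ 1 * + Fo) S≥-Fo)) ⟩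
  + (Fe ℕ.+ Fo) + (+ 1 * - + Fe + (+ 1 * + Fo + S)) ∎))
  where
  open ℤP.≤-Reasoning
  eq : ∀ a b → b ≡ a + b + (+ 1 * - a + (+ 1 * b + - b))
  eq = solve-∀
pair-forced Fe Fo S (s≤s z≤n) z≤n _ _ _ =
  refl , refl , trans (cong (_+ (+ 1 * - + Fe + (0ℤ + S))) (ℤP.pos-+ Fe Fo)) (eq (+ Fe) (+ Fo) S)
  where
  eq : ∀ a b s → a + b + (+ 1 * - a + (0ℤ + s)) ≡ b + s
  eq = solve-∀

-- The negFibSum of the string 1y of length 2R + 1.
afterOne : (ℕ → ℕ) → ℕ → ℤ
afterOne y R = + fib (suc (R ℕ.* 2)) + negFibSum y (R ℕ.* 2)

afterOne-step : ∀ R y → (∀ t → y t ≤ 1) → afterOne y (suc R) ℤ.< + fib (suc (R ℕ.* 2)) →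
                y 0 ≡ 1 × y 1 ≡ 0 × afterOne y (suc R) ≡ afterOne (λ t → y (2 ℕ.+ t)) R
afterOne-step R y y≤1 value<
  with pair-forced Fe Fo _ (y≤1 0) (y≤1 1) (ℕP.m≤m+n Fo (fib (R ℕ.* 2)))
                   (negFibSum-even-≥ R _ (λ t → y≤1 (2 ℕ.+ t)))
                   (subst (ℤ._< + Fo) (cong (_+_ (+ (Fe ℕ.+ Fo))) (negFibSum-pair R y)) value<)
  where
  Fe = fib (suc R ℕ.* 2)
  Fo = fib (suc (R ℕ.* 2))
... | y0≡1 , y1≡0 , value≡ = y0≡1 , y1≡0 , trans (cong (_+_ (+ fib (3 ℕ.+ R ℕ.* 2))) (negFibSum-pair R y)) value≡

afterOne-alternates : ∀ z r y → (∀ t → y t ≤ 1) → afterOne y (z ℕ.+ r) ℤ.< + fib (suc (r ℕ.* 2)) →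
                      ∀ j → j < z → y (j ℕ.* 2) ≡ 1 × y (suc (j ℕ.* 2)) ≡ 0
afterOne-alternates (suc z) r y y≤1 value< j j<1+z
  with afterOne-step (z ℕ.+ r) y y≤1
         (ℤP.<-≤-trans value< (+≤+ (fib-mono (s≤s (ℕP.*-monoˡ-≤ 2 (ℕP.m≤n+m r z))))))
... | y0≡1 , y1≡0 , value≡ with j
...   | zero  = y0≡1 , y1≡0
...   | suc j = afterOne-alternates z r (λ t → y (2 ℕ.+ t)) (λ t → y≤1 (2 ℕ.+ t))
                  (subst (ℤ._< _) value≡ value<) j (ℕP.≤-pred j<1+z)

n*negFib≤fib : ∀ {n} k s → n≤φ^ n k → + n * negFib s ℤ.≤ + fib (suc (k ℕ.+ s))
n*negFib≤fib {n} k s n≤φᵏ = begin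
  + n * negFib s               ≤⟨ ℤP.*-monoˡ-≤-nonNeg (+ n) (negFib≤fib s) ⟩
  + n * + fib s                ≡⟨ ℤP.pos-* n (fib s) ⟨
  + (n ℕ.* fib s)              ≤⟨ +≤+ (ℕP.*-monoˡ-≤ (fib s) (n≤φ^⇒n≤fib {n} k n≤φᵏ)) ⟩
  + (fib (2 ℕ.+ k) ℕ.* fib s)  ≤⟨ +≤+ (fib[1+a]*fib[b]≤fib[a+b] (suc k) s) ⟩
  + fib (suc (k ℕ.+ s))        ∎
  where open ℤP.≤-Reasoning

weight-fibℤ≡afterOne : ∀ {a m} K → a m ≡ 1 →
                       weight (λ j → fibℤ (j - (m + + suc (K ℕ.* 2)))) a m (suc (K ℕ.* 2))
                       ≡ afterOne (λ t → a (m + + suc t)) K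
weight-fibℤ≡afterOne {a} {m} K am≡1 =
  trans (weight-fibℤ≡negFibSum a (λ t → a (m + + t)) m (suc (K ℕ.* 2)) (λ _ → refl))
        (cong (_+ negFibSum (λ t → a (m + + suc t)) (K ℕ.* 2)) (begin
          + a (m + + 0) * negFib (suc (K ℕ.* 2))
            ≡⟨ cong (λ v → + v * _) (trans (cong a (ℤP.+-identityʳ m)) am≡1) ⟩
          + 1 * negFib (suc (K ℕ.* 2))            ≡⟨ ℤP.*-identityˡ _ ⟩
          negFib (suc (K ℕ.* 2))                  ≡⟨ negFib-odd K ⟩
          + fib (suc (K ℕ.* 2))                   ∎))
  where open ≡-Reasoning

window-end : ∀ {m} z k l → - m ≡ + 3 + + 2 * + z + + k →
             m + + suc ((z ℕ.+ suc (k ℕ.+ l)) ℕ.* 2) ≡ + (k ℕ.+ l ℕ.* 2)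
window-end {m} z k l -m≡ = begin
  m + + suc ((z ℕ.+ suc (k ℕ.+ l)) ℕ.* 2)   ≡⟨ cong (λ i → m + + i) (length z k l) ⟩
  m + + (M ℕ.+ s)                           ≡⟨ cong (_+_ m) (ℤP.pos-+ M s) ⟩
  m + (+ M + + s)                           ≡⟨ cong (λ i → m + (i + + s)) -m≡+M ⟨
  m + (- m + + s)                           ≡⟨ cancel m (+ s) ⟩
  + s                                       ∎
  where
  open ≡-Reasoning
  M = 3 ℕ.+ 2 ℕ.* z ℕ.+ k
  s = k ℕ.+ l ℕ.* 2
  length : ∀ z k l → suc ((z ℕ.+ suc (k ℕ.+ l)) ℕ.* 2) ≡ 3 ℕ.+ 2 ℕ.* z ℕ.+ k ℕ.+ (k ℕ.+ l ℕ.* 2)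
  length = ℕ-Solver.solve-∀
  -m≡+M : - m ≡ + M
  -m≡+M = trans -m≡ (sym (trans (ℤP.pos-+ (3 ℕ.+ 2 ℕ.* z) k)
                          (cong (_+ + k) (trans (ℤP.pos-+ 3 (2 ℕ.* z)) (cong (_+_ (+ 3)) (ℤP.pos-* 2 z))))))
  cancel : ∀ m s → m + (- m + s) ≡ s
  cancel = solve-∀

-- r = k + l + 1 makes the window [m, m + N) cover the support and puts its end at k + 2l ≥ 0.
leftEdge-alternates : ∀ {n T m} z k → Reachable (init n) T → (∀ i → T i ≤ 1) → T m ≡ 1 →
                      (∀ i → i ℤ.< m → T i ≡ 0) → - m ≡ + 3 + + 2 * + z + + k → n≤φ^ n k →
                      ∀ j → j < z → T (m + + suc (j ℕ.* 2)) ≡ 1 × T (m + + suc (suc (j ℕ.* 2))) ≡ 0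
leftEdge-alternates {n} {T} {m} z k reach T≤1 Tm≡1 left -m≡ n≤φᵏ
  with leftmost-window-value {n} reach (ℕP.≤-reflexive (sym Tm≡1)) left
... | l , value = afterOne-alternates z r y (λ t → T≤1 (m + + suc t)) (begin-strict
  afterOne y K                   ≡⟨ weight-fibℤ≡afterOne {T} {m} K Tm≡1 ⟨
  weight w T m N                 ≡⟨ value N l≤N w (fibonacciLike-shift {fibℤ} fibℤ-fibonacciLike (m + + N)) ⟩
  + n * fibℤ (0ℤ - (m + + N))    ≡⟨ cong (λ i → + n * fibℤ i) 0-c≡-s ⟩
  + n * fibℤ (- + s)             ≡⟨ cong (+ n *_) (fibℤ-neg s) ⟩
  + n * negFib s                 ≤⟨ n*negFib≤fib {n} k s n≤φᵏ ⟩
  + fib (suc (k ℕ.+ s))          ≡⟨ cong (λ i → + fib (suc i)) (k+s≡[k+l]*2 k l) ⟩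
  + fib (suc ((k ℕ.+ l) ℕ.* 2))  <⟨ +<+ (fib[1+n]<fib[3+n] ((k ℕ.+ l) ℕ.* 2)) ⟩
  + fib (suc (r ℕ.* 2))          ∎)
  where
  open ℤP.≤-Reasoning
  r = suc (k ℕ.+ l)
  K = z ℕ.+ r
  N = suc (K ℕ.* 2)
  s = k ℕ.+ l ℕ.* 2
  w : ℤ → ℤ
  w j = fibℤ (j - (m + + N))
  y : ℕ → ℕ
  y t = T (m + + suc t)
  l≤N : l ≤ N
  l≤N = ℕP.≤-trans (ℕP.≤-trans (ℕP.m≤n+m l k) (ℕP.≤-trans (ℕP.n≤1+n _) (ℕP.m≤n+m _ z)))
                   (ℕP.≤-trans (ℕP.m≤m*n K 2) (ℕP.n≤1+n _))
  0-c≡-s : 0ℤ - (m + + N) ≡ - + s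
  0-c≡-s = trans (cong (_-_ 0ℤ) (window-end z k l -m≡)) (ℤP.+-identityˡ (- + s))
  k+s≡[k+l]*2 : ∀ k l → k ℕ.+ (k ℕ.+ l ℕ.* 2) ≡ (k ℕ.+ l) ℕ.* 2
  k+s≡[k+l]*2 = ℕ-Solver.solve-∀

mainTheorem4 :
    (n : ℕ) → 1 ≤ n →
    (T : State) → Reachable (init n) T →
    (∀ i → T i ≤ 1) →
    (m : ℤ) → 1 ≤ T m → (∀ i → i ℤ.< m → T i ≡ 0) →
    (z k : ℕ) → - m ≡ + 3 + + 2 * + z + + k → n≤φ^ n k →
    (T m ≡ 1)
    × (∀ (j : ℕ) → j < z → T (m + + 2 * + j + + 1) ≡ 1)
    × (∀ (j : ℕ) → 1 ≤ j → j ≤ z → T (m + + 2 * + j) ≡ 0)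
    × (m + + 2 * + z ℤ.< + 0)
mainTheorem4 n _ T reach T≤1 m Tm≥1 left z k -m≡ n≤φᵏ = Tm≡1 , ones , zeros , m+2z<0
  where
  Tm≡1 : T m ≡ 1
  Tm≡1 = ℕP.≤-antisym (T≤1 m) Tm≥1
  alternates : ∀ j → j < z → T (m + + suc (j ℕ.* 2)) ≡ 1 × T (m + + suc (suc (j ℕ.* 2))) ≡ 0
  alternates = leftEdge-alternates {n} z k reach T≤1 Tm≡1 left -m≡ n≤φᵏ
  ones : ∀ j → j < z → T (m + + 2 * + j + + 1) ≡ 1
  ones j j<z = subst (λ i → T i ≡ 1)
    (trans (shift m (+ (j ℕ.* 2))) (cong (λ i → m + i + + 1) (sym (+2*+j≡+[j*2] j))))
    (proj₁ (alternates j j<z))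
    where
    shift : ∀ m x → m + (+ 1 + x) ≡ m + x + + 1
    shift = solve-∀
  zeros : ∀ j → 1 ≤ j → j ≤ z → T (m + + 2 * + j) ≡ 0
  zeros (suc j) _ j<z =
    subst (λ i → T i ≡ 0) (cong (_+_ m) (sym (+2*+j≡+[j*2] (suc j)))) (proj₂ (alternates j j<z))
  m+2z<0 : m + + 2 * + z ℤ.< + 0
  m+2z<0 = subst (ℤ._< + 0) (sym (trans (cong (_+ + 2 * + z) m≡) (eq (+ 2 * + z) (+ k)))) ℤ.-<+
    where
    m≡ : m ≡ - (+ 3 + + 2 * + z + + k)
    m≡ = trans (sym (ℤP.neg-involutive m)) (cong -_ -m≡)
    eq : ∀ a b → - (+ 3 + a + b) + a ≡ - (+ 3 + b)
    eq = solve-∀
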